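{- Let $G$ be a finite simple graph with maximum degree $\Delta$. Then $\chi_{slid}(G)\leq 2\Delta^2-\Delta+1$.
   Context: For a vertex $u$, $N[u]$ is its closed neighbourhood; for a colouring $c$ and vertex set $S$, $c(S)=\{c(u):u\in S\}$. A locally identifying colouring is a proper vertex colouring $c$ such that for every pair of adjacent vertices $u,v$ with $N[u]\neq N[v]$, $c(N[u])\neq c(N[v])$. A strong locally identifying colouring (slid-colouring) is a locally identifying colouring in which, for each vertex $u$, all colours in $N[u]$ are distinct (i.e. any two vertices at distance at most $2$ get different colours). $\chi_{slid}(G)$ is the minimum number of colours in a slid-colouring of $G$. -}

module Defs where

open import Data.Nat using (ℕ; zero; suc; _+_; _⊔_)
open import Data.Bool using (Bool; true; false; T)
open import Data.Fin using (Fin)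
open import Data.List using (List; map; foldr; length; filter; allFin)
open import Data.Product using (_×_; ∃-syntax)
open import Relation.Nullary using (¬_)
open import Relation.Binary.PropositionalEquality using (_≡_; _≢_)
open import Data.Bool.Properties using (T?)
open import Function.Bundles using (_⇔_)

record Graph (n : ℕ) : Set where
  field
    adj     : Fin n → Fin n → Bool
    sym     : ∀ u v → adj u v ≡ adj v u
    irrefl  : ∀ u → adj u u ≡ false
open Graph public

degree : ∀ {n} → Graph n → Fin n → ℕ
degree {n} G u = length (filter (λ v → T? (adj G u v)) (allFin n))

maxDegree : ∀ {n} → Graph n → ℕ
maxDegree {n} G = foldr (λ u m → degree G u ⊔ m) 0 (allFin n)

InN : ∀ {n} → Graph n → Fin n → Fin n → Set
InN G u w = (w ≡ u) ⊎' T (adj G u w)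
  where
  open import Data.Sum using () renaming (_⊎_ to _⊎'_)

InColN : ∀ {n k} → Graph n → (Fin n → Fin k) → Fin n → Fin k → Set
InColN G c u x = ∃[ w ] (InN G u w × c w ≡ x)

Proper : ∀ {n k} → Graph n → (Fin n → Fin k) → Set
Proper G c = ∀ u v → T (adj G u v) → c u ≢ c v

LocallyIdentifying : ∀ {n k} → Graph n → (Fin n → Fin k) → Set
LocallyIdentifying {n} {k} G c =
  Proper G c ×
  (∀ u v → T (adj G u v) →
     ¬ (∀ w → InN G u w ⇔ InN G v w) →
     ¬ (∀ (x : Fin k) → InColN G c u x ⇔ InColN G c v x))

SlidColouring : ∀ {n k} → Graph n → (Fin n → Fin k) → Set
SlidColouring G c =
  LocallyIdentifying G c ×
  (∀ u w₁ w₂ → InN G u w₁ → InN G u w₂ → w₁ ≢ w₂ → c w₁ ≢ c w₂)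

HasSlidColouring : ∀ {n} → Graph n → ℕ → Set
HasSlidColouring {n} G k = ∃[ c ] SlidColouring {n} {k} G c

-- Colour the vertices greedily in index order. When x is coloured, avoid the colours of all
-- vertices within distance 2 of x, and, for every path x – u – v, the colour of one vertex
-- w ∈ N[v] ∖ N[u] coloured before x whose colour does not occur on the part of N[u] ∖ N[v]
-- coloured before x (if there is such a w). That forbids at most Δ(1 + 2(Δ − 1)) = 2Δ² − Δ
-- colours, and distance-2 vertices get distinct colours. If adjacent u, v had N[u] ≠ N[v] but
-- c(N[u]) = c(N[v]), let x be the last vertex of N[u] △ N[v], say x ∈ N[u] ∖ N[v]. The colour
-- of x occurs at some earlier w ∈ N[v] ∖ N[u], so when x was coloured an unmatched vertex
-- existed for (u, v) and x avoided the colour of one of them, w'. But c(w') also occurs in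
-- N[u], necessarily on N[u] ∖ N[v] before x: a contradiction.
module Submission where

open import Defs
open import Data.Nat using (ℕ; _+_; _*_; _∸_)
open import Data.Nat as ℕ using (zero; suc; _≤_; _<_; _⊔_; z≤n; s≤s; z<s)
import Data.Nat.Properties as ℕₚ
open import Data.Nat.Tactic.RingSolver using (solve-∀)
open import Data.Fin as Fin using (Fin; toℕ; fromℕ<)
import Data.Fin.Properties as Finₚ
open import Data.List using (List; []; _∷_; [_]; length; filter; allFin; foldr; concatMap; lookup)
open import Data.List.Properties using (length-++; filter-notAll)
open import Data.List.Membership.Propositional using (_∈_; _∉_; lose)
open import Data.List.Membership.Propositional.Properties using (∈-filter⁺; ∈-filter⁻; ∈-allFin; ∈-concatMap⁺)
open import Data.List.Relation.Unary.Any as Any using (here; there; index)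
open import Data.List.Relation.Unary.Any.Properties using (lookup-index)
open import Data.Bool using (T)
open import Data.Bool.Properties using (T?)
open import Data.Product using (_×_; _,_; proj₁; proj₂; ∃)
open import Data.Sum using (_⊎_; inj₁; inj₂) renaming (swap to ⊎-swap)
open import Data.Empty using (⊥)
open import Relation.Nullary using (¬_; Dec; yes; no; ¬?; contradiction)
open import Relation.Nullary.Decidable using (_×-dec_; _⊎-dec_; _→-dec_; decidable-stable)
open import Relation.Unary using (Decidable)
open import Relation.Binary.Definitions using (tri<; tri≈; tri>)
open import Relation.Binary.PropositionalEquality as ≡
  using (_≡_; _≢_; refl; trans; cong; subst; module ≡-Reasoning)
open import Function using (_∘_)
open import Function.Bundles using (_⇔_; Equivalence; mk⇔)
open import Function.Properties.Equivalence using () renaming (sym to ⇔-sym)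

≤-foldr-⊔ : ∀ {A : Set} (f : A → ℕ) {a} (xs : List A) → a ∈ xs → f a ≤ foldr (λ b m → f b ⊔ m) 0 xs
≤-foldr-⊔ f (b ∷ xs) (here refl) = ℕₚ.m≤m⊔n (f b) _
≤-foldr-⊔ f (b ∷ xs) (there a∈xs) = ℕₚ.m≤n⇒m≤o⊔n (f b) (≤-foldr-⊔ f xs a∈xs)

length-concatMap-≤ : ∀ {A B : Set} (f : A → List B) {c} (xs : List A) →
                     (∀ {a} → a ∈ xs → length (f a) ≤ c) → length (concatMap f xs) ≤ length xs * c
length-concatMap-≤ f []       _ = z≤n
length-concatMap-≤ f (a ∷ xs) h rewrite length-++ (f a) {concatMap f xs} =
  ℕₚ.+-mono-≤ (h (here refl)) (length-concatMap-≤ f xs (h ∘ there))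

-- If every z were in xs, z ↦ (position of z in xs) would inject Fin k into Fin (length xs).
∃∉-of-length< : ∀ {k} (xs : List (Fin k)) → length xs < k → ∃ (_∉ xs)
∃∉-of-length< {k} xs |xs|<k with Finₚ.all? (λ z → Any.any? (z Finₚ.≟_) xs)
... | no ¬all = Finₚ.¬∀⟶∃¬ k _ (λ z → Any.any? (z Finₚ.≟_) xs) ¬all
... | yes all with Finₚ.pigeonhole |xs|<k (λ z → index (all z))
...   | i , j , i<j , same-index = contradiction i≡j (Finₚ.<⇒≢ i<j)
  where
  i≡j : i ≡ j
  i≡j = trans (lookup-index (all i)) (trans (cong (lookup xs) same-index) (≡.sym (lookup-index (all j))))

∃-maximal : ∀ {n} {P : Fin n → Set} → Decidable P → ∃ P → ∃ λ x → P x × (∀ y → P y → y Fin.≤ x)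
∃-maximal {suc n} P? (w , pw) with Finₚ.any? (P? ∘ Fin.suc)
... | yes ∃P∘suc with ∃-maximal (P? ∘ Fin.suc) ∃P∘suc
...   | x , px , x-max = Fin.suc x , px , λ { Fin.zero _ → z≤n ; (Fin.suc y) py → s≤s (x-max y py) }
∃-maximal {suc n} P? (Fin.zero , pw)  | no ¬∃P∘suc =
  Fin.zero , pw , λ { Fin.zero _ → z≤n ; (Fin.suc y) py → contradiction (y , py) ¬∃P∘suc }
∃-maximal {suc n} P? (Fin.suc w , pw) | no ¬∃P∘suc = contradiction (w , pw) ¬∃P∘suc

Δ*[2Δ-1]≡2Δ²-Δ : ∀ d → d * suc ((d ∸ 1) * 2) ≡ 2 * (d * d) ∸ d
Δ*[2Δ-1]≡2Δ²-Δ zero    = refl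
Δ*[2Δ-1]≡2Δ²-Δ (suc e) = ≡.sym (begin
  2 * (suc e * suc e) ∸ suc e                   ≡⟨ cong (_∸ suc e) (expand e) ⟩
  suc e * suc ((suc e ∸ 1) * 2) + suc e ∸ suc e ≡⟨ ℕₚ.m+n∸n≡m _ (suc e) ⟩
  suc e * suc ((suc e ∸ 1) * 2)                 ∎)
  where
  open ≡-Reasoning
  expand : ∀ e → 2 * (suc e * suc e) ≡ suc e * suc (e * 2) + suc e
  expand = solve-∀

-- colourUpTo m has coloured the vertices 0, …, m − 1 greedily and gives the rest c₀.
module Greedy {n} {C : Set} (c₀ : C) (choose : (Fin n → C) → Fin n → C) where

  colourUpTo : ℕ → Fin n → C
  colourUpTo zero    _ = c₀
  colourUpTo (suc m) y with toℕ y ℕ.≟ m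
  ... | yes _ = choose (colourUpTo m) y
  ... | no  _ = colourUpTo m y

  colour : Fin n → C
  colour = colourUpTo n

  stage : Fin n → Fin n → C
  stage x = colourUpTo (toℕ x)

  colourUpTo-suc-self : ∀ y → colourUpTo (suc (toℕ y)) y ≡ choose (stage y) y
  colourUpTo-suc-self y with toℕ y ℕ.≟ toℕ y
  ... | yes _  = refl
  ... | no y≢y = contradiction refl y≢y

  colourUpTo-stable : ∀ m y → toℕ y < m → colourUpTo m y ≡ colourUpTo (suc (toℕ y)) y
  colourUpTo-stable (suc m) y y<1+m with toℕ y ℕ.≟ m
  ... | yes refl = ≡.sym (colourUpTo-suc-self y)
  ... | no  y≢m  = colourUpTo-stable m y (ℕₚ.≤∧≢⇒< (ℕₚ.≤-pred y<1+m) y≢m)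

  colour-chosen : ∀ x → colour x ≡ choose (stage x) x
  colour-chosen x = trans (colourUpTo-stable n x (Finₚ.toℕ<n x)) (colourUpTo-suc-self x)

  stage-agrees : ∀ {x y} → y Fin.< x → stage x y ≡ colour y
  stage-agrees {x} {y} y<x =
    trans (colourUpTo-stable (toℕ x) y y<x) (≡.sym (colourUpTo-stable n y (Finₚ.toℕ<n y)))

module Construction {n} (G : Graph n) where

  Δ : ℕ
  Δ = maxDegree G

  Colour : Set
  Colour = Fin (2 * (Δ * Δ) ∸ Δ + 1)

  adj-sym : ∀ {u v} → T (adj G u v) → T (adj G v u)
  adj-sym {u} {v} = subst T (Graph.sym G u v)

  adj⇒≢ : ∀ {u v} → T (adj G u v) → u ≢ v
  adj⇒≢ {u} {v} uv refl = subst T (irrefl G u) uv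

  InN⇒adj : ∀ {u w} → InN G u w → w ≢ u → T (adj G u w)
  InN⇒adj (inj₁ w≡u) w≢u = contradiction w≡u w≢u
  InN⇒adj (inj₂ uw)  _   = uw

  InN? : ∀ u w → Dec (InN G u w)
  InN? u w = (w Finₚ.≟ u) ⊎-dec T? (adj G u w)

  neighbours : Fin n → List (Fin n)
  neighbours u = filter (T? ∘ adj G u) (allFin n)

  ∈-neighbours : ∀ {u v} → T (adj G u v) → v ∈ neighbours u
  ∈-neighbours {u} {v} = ∈-filter⁺ (T? ∘ adj G u) (∈-allFin v)

  length-neighbours : ∀ u → length (neighbours u) ≤ Δ
  length-neighbours u = ≤-foldr-⊔ (degree G) (allFin n) (∈-allFin u)

  othersThan : Fin n → Fin n → List (Fin n)
  othersThan x u = filter (λ v → ¬? (v Finₚ.≟ x)) (neighbours u)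

  length-othersThan : ∀ {x u} → T (adj G u x) → length (othersThan x u) ≤ Δ ∸ 1
  length-othersThan {x} {u} ux = ℕₚ.<⇒≤pred (ℕₚ.<-≤-trans
    (filter-notAll (λ v → ¬? (v Finₚ.≟ x)) (neighbours u) (lose (∈-neighbours ux) (λ x≢x → x≢x refl)))
    (length-neighbours u))

  Unmatched : (Fin n → Colour) → Fin n → Fin n → Fin n → Fin n → Set
  Unmatched p x u v w = InN G v w × ¬ InN G u w × w Fin.< x ×
    (∀ y → InN G u y → ¬ InN G v y → y Fin.< x → p y ≢ p w)

  Unmatched? : ∀ p x u v → Decidable (Unmatched p x u v)
  Unmatched? p x u v w = InN? v w ×-dec ¬? (InN? u w) ×-dec (w Finₚ.<? x) ×-dec
    Finₚ.all? (λ y → InN? u y →-dec ¬? (InN? v y) →-dec (y Finₚ.<? x) →-dec ¬? (p y Finₚ.≟ p w))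

  unmatchedColour : (Fin n → Colour) → Fin n → Fin n → Fin n → List Colour
  unmatchedColour p x u v with Finₚ.any? (Unmatched? p x u v)
  ... | yes (w , _) = [ p w ]
  ... | no  _       = []

  length-unmatchedColour : ∀ p x u v → length (unmatchedColour p x u v) ≤ 1
  length-unmatchedColour p x u v with Finₚ.any? (Unmatched? p x u v)
  ... | yes _ = s≤s z≤n
  ... | no  _ = z≤n

  ∈-unmatchedColour : ∀ {p x u v} → ∃ (Unmatched p x u v) →
                      ∃ λ w → Unmatched p x u v w × p w ∈ unmatchedColour p x u v
  ∈-unmatchedColour {p} {x} {u} {v} ∃w with Finₚ.any? (Unmatched? p x u v)
  ... | yes (w , unmatched) = w , unmatched , here refl
  ... | no  ∄w              = contradiction ∃w ∄w

  forbiddenVia : (Fin n → Colour) → Fin n → Fin n → List Colour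
  forbiddenVia p x u = p u ∷ concatMap (λ v → p v ∷ unmatchedColour p x u v) (othersThan x u)

  forbidden : (Fin n → Colour) → Fin n → List Colour
  forbidden p x = concatMap (forbiddenVia p x) (neighbours x)

  length-forbiddenVia : ∀ p {x u} → T (adj G x u) → length (forbiddenVia p x u) ≤ suc ((Δ ∸ 1) * 2)
  length-forbiddenVia p {x} {u} xu = s≤s (ℕₚ.≤-trans
    (length-concatMap-≤ _ (othersThan x u) (λ {v} _ → s≤s (length-unmatchedColour p x u v)))
    (ℕₚ.*-monoˡ-≤ 2 (length-othersThan (adj-sym xu))))

  length-forbidden : ∀ p x → length (forbidden p x) < 2 * (Δ * Δ) ∸ Δ + 1
  length-forbidden p x = ℕₚ.≤-<-trans (begin
    length (forbidden p x)                    ≤⟨ length-concatMap-≤ _ (neighbours x) via-neighbour ⟩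
    length (neighbours x) * suc ((Δ ∸ 1) * 2) ≤⟨ ℕₚ.*-monoˡ-≤ _ (length-neighbours x) ⟩
    Δ * suc ((Δ ∸ 1) * 2)                     ≡⟨ Δ*[2Δ-1]≡2Δ²-Δ Δ ⟩
    2 * (Δ * Δ) ∸ Δ                           ∎) (ℕₚ.m<m+n _ z<s)
    where
    open ℕₚ.≤-Reasoning
    via-neighbour : ∀ {u} → u ∈ neighbours x → length (forbiddenVia p x u) ≤ suc ((Δ ∸ 1) * 2)
    via-neighbour u∈ = length-forbiddenVia p (proj₂ (∈-filter⁻ (T? ∘ adj G x) {xs = allFin n} u∈))

  abstract
    choose : (Fin n → Colour) → Fin n → Colour
    choose p x = proj₁ (∃∉-of-length< (forbidden p x) (length-forbidden p x))

    choose-∉ : ∀ p x {c} → c ∈ forbidden p x → c ≢ choose p x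
    choose-∉ p x c∈ refl = proj₂ (∃∉-of-length< (forbidden p x) (length-forbidden p x)) c∈

  ∈-forbidden : ∀ {p x u c} → T (adj G x u) → c ∈ forbiddenVia p x u → c ∈ forbidden p x
  ∈-forbidden xu c∈ = ∈-concatMap⁺ _ (lose (∈-neighbours xu) c∈)

  ∈-forbiddenVia : ∀ {p x u v c} → T (adj G u v) → v ≢ x →
                   c ∈ p v ∷ unmatchedColour p x u v → c ∈ forbiddenVia p x u
  ∈-forbiddenVia {x = x} uv v≢x c∈ =
    there (∈-concatMap⁺ _ (lose (∈-filter⁺ (λ v → ¬? (v Finₚ.≟ x)) (∈-neighbours uv) v≢x) c∈))

  choose-≢-in-N : ∀ p {u a b} → InN G u a → InN G u b → a ≢ b → p a ≢ choose p b
  choose-≢-in-N p (inj₁ refl) (inj₁ refl) a≢b = contradiction refl a≢b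
  choose-≢-in-N p (inj₁ refl) (inj₂ ub)   a≢b = choose-∉ p _ (∈-forbidden (adj-sym ub) (here refl))
  choose-≢-in-N p (inj₂ ua)   (inj₁ refl) a≢b = choose-∉ p _ (∈-forbidden ua (here refl))
  choose-≢-in-N p (inj₂ ua)   (inj₂ ub)   a≢b =
    choose-∉ p _ (∈-forbidden (adj-sym ub) (∈-forbiddenVia ua a≢b (here refl)))

  choose-≢-unmatched : ∀ p {x u v} → T (adj G x u) → T (adj G u v) → v ≢ x → ∃ (Unmatched p x u v) →
                       ∃ λ w → Unmatched p x u v w × p w ≢ choose p x
  choose-≢-unmatched p xu uv v≢x ∃w with ∈-unmatchedColour ∃w
  ... | w , unmatched , pw∈ = w , unmatched , choose-∉ p _ (∈-forbidden xu (∈-forbiddenVia uv v≢x (there pw∈)))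

  open Greedy (fromℕ< (ℕₚ.m<m+n _ z<s)) choose public

  colour-distinct-in-N-< : ∀ {u a b} → InN G u a → InN G u b → a ≢ b → a Fin.< b → colour a ≢ colour b
  colour-distinct-in-N-< a∈ b∈ a≢b a<b ca≡cb =
    choose-≢-in-N _ a∈ b∈ a≢b (trans (stage-agrees a<b) (trans ca≡cb (colour-chosen _)))

  colour-distinct-in-N : ∀ {u a b} → InN G u a → InN G u b → a ≢ b → colour a ≢ colour b
  colour-distinct-in-N {a = a} {b} a∈ b∈ a≢b with Finₚ.<-cmp a b
  ... | tri< a<b _ _ = colour-distinct-in-N-< a∈ b∈ a≢b a<b
  ... | tri≈ _ a≡b _ = contradiction a≡b a≢b
  ... | tri> _ _ b<a = colour-distinct-in-N-< b∈ a∈ (a≢b ∘ ≡.sym) b<a ∘ ≡.sym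

  SymDiff : Fin n → Fin n → Fin n → Set
  SymDiff u v y = (InN G u y × ¬ InN G v y) ⊎ (InN G v y × ¬ InN G u y)

  SymDiff? : ∀ u v → Decidable (SymDiff u v)
  SymDiff? u v y = (InN? u y ×-dec ¬? (InN? v y)) ⊎-dec (InN? v y ×-dec ¬? (InN? u y))

  ∃-SymDiff : ∀ {u v} → ¬ (∀ w → InN G u w ⇔ InN G v w) → ∃ (SymDiff u v)
  ∃-SymDiff {u} {v} N[u]≢N[v] with Finₚ.any? (SymDiff? u v)
  ... | yes ∃y = ∃y
  ... | no  ∄y = contradiction (λ w → mk⇔
    (λ w∈u → decidable-stable (InN? v w) (λ w∉v → ∄y (w , inj₁ (w∈u , w∉v))))
    (λ w∈v → decidable-stable (InN? u w) (λ w∉u → ∄y (w , inj₂ (w∈v , w∉u))))) N[u]≢N[v]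

  SameColours : Fin n → Fin n → Set
  SameColours u v = ∀ k → InColN G colour u k ⇔ InColN G colour v k

  module _ {u v x} (uv : T (adj G u v)) (x∈u : InN G u x) (x∉v : ¬ InN G v x)
           (x-max : ∀ y → SymDiff u v y → y Fin.≤ x) where

    before-x : ∀ {y} → SymDiff u v y → y ≢ x → y Fin.< x
    before-x d y≢x = Finₚ.≤∧≢⇒< (x-max _ d) y≢x

    ux : T (adj G u x)
    ux = InN⇒adj x∈u (λ x≡u → x∉v (subst (InN G v) (≡.sym x≡u) (inj₂ (adj-sym uv))))

    unmatched-exists : SameColours u v → ∃ (Unmatched (stage x) x u v)
    unmatched-exists same with Equivalence.to (same (colour x)) (x , x∈u , refl)
    ... | w , w∈v , cw≡cx = w , w∈v , w∉u , w<x , unmatched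
      where
      w≢x : w ≢ x
      w≢x refl = x∉v w∈v
      w∉u : ¬ InN G u w
      w∉u w∈u = colour-distinct-in-N w∈u x∈u w≢x cw≡cx
      w<x : w Fin.< x
      w<x = before-x (inj₂ (w∈v , w∉u)) w≢x
      unmatched : ∀ y → InN G u y → ¬ InN G v y → y Fin.< x → stage x y ≢ stage x w
      unmatched y y∈u _ y<x sy≡sw = colour-distinct-in-N y∈u x∈u (Finₚ.<⇒≢ y<x) (begin
        colour y    ≡⟨ stage-agrees y<x ⟨
        stage x y   ≡⟨ sy≡sw ⟩
        stage x w   ≡⟨ stage-agrees w<x ⟩
        colour w    ≡⟨ cw≡cx ⟩
        colour x    ∎)
        where open ≡-Reasoning

    unmatched-absurd : SameColours u v → ∀ {w} → Unmatched (stage x) x u v w →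
                       stage x w ≢ choose (stage x) x → ⊥
    unmatched-absurd same {w} (w∈v , w∉u , w<x , unmatched) sw≢cx =
      matched-in-N[u] (Equivalence.from (same (colour w)) (w , w∈v , refl))
      where
      matched-in-N[u] : InColN G colour u (colour w) → ⊥
      matched-in-N[u] (z , z∈u , cz≡cw) = by-cases (z Finₚ.≟ x) (InN? v z)
        where
        by-cases : Dec (z ≡ x) → Dec (InN G v z) → ⊥
        by-cases (yes z≡x) _ = sw≢cx (begin
          stage x w           ≡⟨ stage-agrees w<x ⟩
          colour w            ≡⟨ cz≡cw ⟨
          colour z            ≡⟨ cong colour z≡x ⟩
          colour x            ≡⟨ colour-chosen x ⟩
          choose (stage x) x  ∎)
          where open ≡-Reasoning
        by-cases (no z≢x) (yes z∈v) = colour-distinct-in-N z∈v w∈v (λ z≡w → w∉u (subst (InN G u) z≡w z∈u)) cz≡cw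
        by-cases (no z≢x) (no  z∉v) = unmatched z z∈u z∉v z<x
          (trans (stage-agrees z<x) (trans cz≡cw (≡.sym (stage-agrees w<x))))
          where
          z<x : z Fin.< x
          z<x = before-x (inj₁ (z∈u , z∉v)) z≢x

    ¬same-colours : ¬ SameColours u v
    ¬same-colours same
      with choose-≢-unmatched (stage x) (adj-sym ux) uv (λ v≡x → x∉v (inj₁ (≡.sym v≡x))) (unmatched-exists same)
    ... | w , unmatched , sw≢cx = unmatched-absurd same unmatched sw≢cx

  slidColouring : SlidColouring G colour
  slidColouring = (proper , separating) , λ _ _ _ → colour-distinct-in-N
    where
    proper : Proper G colour
    proper u v uv = colour-distinct-in-N (inj₁ refl) (inj₂ uv) (adj⇒≢ uv)
    separating : ∀ u v → T (adj G u v) → ¬ (∀ w → InN G u w ⇔ InN G v w) → ¬ SameColours u v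
    separating u v uv N[u]≢N[v] = at-last-difference (∃-maximal (SymDiff? u v) (∃-SymDiff N[u]≢N[v]))
      where
      at-last-difference : ∃ (λ x → SymDiff u v x × (∀ y → SymDiff u v y → y Fin.≤ x)) → ¬ SameColours u v
      at-last-difference (x , inj₁ (x∈u , x∉v) , x-max) = ¬same-colours uv x∈u x∉v x-max
      at-last-difference (x , inj₂ (x∈v , x∉u) , x-max) =
        ¬same-colours (adj-sym uv) x∈v x∉u (λ y → x-max y ∘ ⊎-swap) ∘ (λ same k → ⇔-sym (same k))

mainTheorem7 : ∀ {n} (G : Graph n) →
    HasSlidColouring G (2 * (maxDegree G * maxDegree G) ∸ maxDegree G + 1)
mainTheorem7 G = Construction.colour G , Construction.slidColouring G
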